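{- Let $R=GF(2)[X]$, let $p(X)\in R$ be a primitive irreducible polynomial of degree $m>1$, and let $n=2^m-1$. Let $f(X)\in R$ have weight $w$, and write $f(X)=g(X)+h(X)$, where $g(X)\in T_{2i}$ for some integer $i\ge 0$, $h(X)\in R$ has weight $j$, no two exponents of $h(X)$ are congruent modulo $n$, and the terms (monomials) of $g(X)$ and $h(X)$ are disjoint (so $w=2i+j$). Then $f(X)$ is divisible by $p(X)$ if and only if $\phi(h(X))\in A_j$.
   Context: The weight of a polynomial in $R$ is its number of nonzero terms. $T_2$ is the set of polynomials $X^a+X^b\in R$ with $0\le a<b$ and $a\equiv b \pmod n$. For $k\ge 2$, $T_{2k}$ is the set of sums of $k$ disjoint elements of $T_2$ (i.e. all $2k$ monomials involved are distinct); by convention $T_0=\{0\}$. $H$ is the binary Hamming code of length $n$ with generator polynomial $p(X)$, i.e. the set of polynomials of degree $<n$ (identified with residue classes in $R/(X^n-1)$) that are divisible by $p(X)$; $A_w$ denotes the set of codewords of $H$ of weight $w$. For $h(X)\in R$, $\phi(h(X))$ is the polynomial obtained from $h(X)$ by reducing every exponent modulo $n$ (i.e. its image in $R/(X^n-1)$ written as a polynomial of degree $<n$). -}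

module Defs where

open import Data.Bool using (Bool; true; false; _xor_; if_then_else_)
open import Data.Nat using (ℕ; zero; suc; _+_; _*_; _∸_; _^_; _<_; _≤_; NonZero; >-nonZero; s≤s; z≤n)
open import Data.Nat.DivMod using (_%_)
open import Data.Nat.Properties using (m^n>0; m<n⇒0<n∸m; +-mono-≤; ≤-trans; m≤m+n)
open import Data.List using (List; []; _∷_; replicate; _++_; length; map; concatMap; foldr)
open import Data.List.Relation.Unary.Unique.Propositional using (Unique)
open import Data.List.Relation.Unary.All using (All)
open import Data.Product using (Σ; ∃; _×_; _,_)
open import Data.Empty using (⊥)
open import Relation.Binary.PropositionalEquality using (_≡_; _≢_)
open import Relation.Nullary using (¬_)

-- Polynomials over GF(2): little-endian coefficient lists
-- (index k = coefficient of X^k); trailing zeros are irrelevant,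
-- equality is coefficientwise (_≈_).
Poly : Set
Poly = List Bool

coeff : Poly → ℕ → Bool
coeff []       _       = false
coeff (c ∷ _)  zero    = c
coeff (_ ∷ cs) (suc k) = coeff cs k

_≈_ : Poly → Poly → Set
f ≈ g = ∀ k → coeff f k ≡ coeff g k

infix 4 _≈_
infixl 6 _⊕_
infixl 7 _⊗_

_⊕_ : Poly → Poly → Poly
[]       ⊕ g        = g
(a ∷ f)  ⊕ []       = a ∷ f
(a ∷ f)  ⊕ (b ∷ g)  = (a xor b) ∷ (f ⊕ g)

_⊗_ : Poly → Poly → Poly
[]      ⊗ g = []
(a ∷ f) ⊗ g = (if a then g else []) ⊕ (false ∷ (f ⊗ g))

zeroP : Poly
zeroP = []

oneP : Poly
oneP = true ∷ []

mono : ℕ → Poly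
mono a = replicate a false ++ (true ∷ [])

_∣P_ : Poly → Poly → Set
p ∣P f = Σ Poly (λ q → f ≈ p ⊗ q)

weight : Poly → ℕ
weight []          = 0
weight (true ∷ f)  = suc (weight f)
weight (false ∷ f) = weight f

HasDegree : Poly → ℕ → Set
HasDegree f d = coeff f d ≡ true × (∀ k → d < k → coeff f k ≡ false)

DegreeBelow : Poly → ℕ → Set
DegreeBelow f n = ∀ k → n ≤ k → coeff f k ≡ false

-- irreducible: not a constant, and every factorization has a unit
-- (the only unit of GF(2)[X] is 1) as a factor
Irreducible : Poly → Set
Irreducible p = ¬ (p ≈ zeroP) × ¬ (p ≈ oneP)
  × (∀ a b → p ≈ a ⊗ b → a ≈ oneP Data.Sum.⊎ b ≈ oneP)
  where import Data.Sum

-- primitive (of degree m): the order of X modulo p is 2^m - 1, i.e.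
-- p divides X^(2^m-1) + 1 but no X^k + 1 with 0 < k < 2^m - 1
Primitive : ℕ → Poly → Set
Primitive m p = (p ∣P (mono (2 ^ m ∸ 1) ⊕ oneP))
  × (∀ k → 0 < k → k < 2 ^ m ∸ 1 → ¬ (p ∣P (mono k ⊕ oneP)))

nonZero-n : ∀ m → 1 < m → NonZero (2 ^ m ∸ 1)
nonZero-n (suc m) _ = >-nonZero (m<n⇒0<n∸m lem)
  where
    lem : 1 < 2 ^ suc m
    lem = +-mono-≤ (m^n>0 2 m) (≤-trans (m^n>0 2 m) (m≤m+n _ 0))

module _ (n : ℕ) .{{_ : NonZero n}} where

  CongMod : ℕ → ℕ → Set
  CongMod a b = a % n ≡ b % n

  -- an element X^a + X^b of T_2, encoded by the pair (a , b)
  ValidPair : ℕ × ℕ → Set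
  ValidPair (a , b) = a < b × CongMod a b

  pairExps : ℕ × ℕ → List ℕ
  pairExps (a , b) = a ∷ b ∷ []

  pairPoly : ℕ × ℕ → Poly
  pairPoly (a , b) = mono a ⊕ mono b

  -- g ∈ T_{2i}: g is the sum of i elements of T_2 whose 2i monomials
  -- are pairwise distinct (i = 0 gives T_0 = {0})
  InT : ℕ → Poly → Set
  InT i g = Σ (List (ℕ × ℕ)) λ ps →
    length ps ≡ i × All ValidPair ps × Unique (concatMap pairExps ps)
    × g ≈ foldr (λ pr acc → pairPoly pr ⊕ acc) zeroP ps

  phiAux : ℕ → Poly → Poly
  phiAux k []          = zeroP
  phiAux k (true ∷ f)  = mono (k % n) ⊕ phiAux (suc k) f
  phiAux k (false ∷ f) = phiAux (suc k) f

  phi : Poly → Poly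
  phi = phiAux 0

  InH : Poly → Poly → Set
  InH p c = DegreeBelow c n × p ∣P c

  InA : Poly → ℕ → Poly → Set
  InA p w c = InH p c × weight c ≡ w

-- Since p divides X^n + 1, every monomial X^a is congruent to X^(a mod n) modulo p.
-- Hence each X^a + X^b ∈ T₂ is divisible by p, so g ≡ 0 and h ≡ φ(h) modulo p,
-- and p ∣ f exactly when p ∣ φ(h).  As the exponents of h are pairwise
-- incongruent modulo n, no two terms of h collide under φ: φ(h) has degree < n
-- and weight j, so p ∣ φ(h) says precisely φ(h) ∈ A_j.
module Submission where

open import Defs
open import Algebra.Bundles using (CommutativeSemigroup)
open import Data.Bool using (true; false; _xor_)
open import Data.Bool.Properties using (xor-assoc; xor-comm; xor-same; xor-identityʳ)
open import Data.Empty using (⊥; ⊥-elim)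
open import Data.List using (List; []; _∷_; replicate; _++_; foldr)
open import Data.List.Relation.Unary.All using (All; []; _∷_)
open import Data.Nat using (ℕ; zero; suc; _+_; _*_; _/_; _<_; _^_; _∸_; NonZero)
open import Data.Nat.DivMod using (_%_; m%n<n; m≡m%n+[m/n]*n)
open import Data.Nat.Properties using (+-assoc; +-identityʳ; +-suc; suc-injective; <⇒≢; <-≤-trans)
open import Data.Product using (_×_; _,_)
open import Function using (_∘_)
open import Function.Bundles using (_⇔_; mk⇔; Equivalence)
open import Relation.Binary.Bundles using (Setoid)
open import Relation.Binary.Structures using (IsEquivalence)
open import Relation.Binary.PropositionalEquality
  using (_≡_; _≢_; refl; sym; trans; cong; cong₂; module ≡-Reasoning)
  renaming (isEquivalence to ≡-isEquivalence)
open import Relation.Nullary using (¬_)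
import Relation.Binary.Reasoning.Setoid as SetoidReasoning

coeff-⊕ : ∀ f g k → coeff (f ⊕ g) k ≡ coeff f k xor coeff g k
coeff-⊕ []      g       k       = refl
coeff-⊕ (a ∷ f) []      zero    = sym (xor-identityʳ a)
coeff-⊕ (a ∷ f) []      (suc k) = sym (xor-identityʳ (coeff f k))
coeff-⊕ (a ∷ f) (b ∷ g) zero    = refl
coeff-⊕ (a ∷ f) (b ∷ g) (suc k) = coeff-⊕ f g k

⊕-identityʳ : ∀ f → f ⊕ [] ≡ f
⊕-identityʳ []      = refl
⊕-identityʳ (a ∷ f) = refl

⊕-comm : ∀ f g → f ⊕ g ≡ g ⊕ f
⊕-comm []      g       = sym (⊕-identityʳ g)
⊕-comm (a ∷ f) []      = refl
⊕-comm (a ∷ f) (b ∷ g) = cong₂ _∷_ (xor-comm a b) (⊕-comm f g)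

⊕-assoc : ∀ f g h → (f ⊕ g) ⊕ h ≡ f ⊕ (g ⊕ h)
⊕-assoc []      g       h       = refl
⊕-assoc (a ∷ f) []      h       = refl
⊕-assoc (a ∷ f) (b ∷ g) []      = refl
⊕-assoc (a ∷ f) (b ∷ g) (c ∷ h) = cong₂ _∷_ (xor-assoc a b c) (⊕-assoc f g h)

⊕-commutativeSemigroup : CommutativeSemigroup _ _
⊕-commutativeSemigroup = record
  { isCommutativeSemigroup = record
    { isSemigroup = record
      { isMagma = record { isEquivalence = ≡-isEquivalence ; ∙-cong = cong₂ _⊕_ }
      ; assoc   = ⊕-assoc
      }
    ; comm = ⊕-comm
    }
  }

open import Algebra.Properties.CommutativeSemigroup ⊕-commutativeSemigroup
  using () renaming (interchange to ⊕-interchange)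

-- Coefficientwise equality _≈_ unfolds to a Π-type, which blocks inference of the
-- polynomials it relates; this wrapper keeps them visible to unification.
infix 4 _≋_
record _≋_ (f g : Poly) : Set where
  constructor coeffwise
  field ≋⇒≈ : f ≈ g
open _≋_

≋-isEquivalence : IsEquivalence _≋_
≋-isEquivalence = record
  { refl  = coeffwise λ k → refl
  ; sym   = λ (coeffwise e) → coeffwise (sym ∘ e)
  ; trans = λ (coeffwise e) (coeffwise e′) → coeffwise λ k → trans (e k) (e′ k)
  }

≋-setoid : Setoid _ _
≋-setoid = record { isEquivalence = ≋-isEquivalence }

open Setoid ≋-setoid using () renaming (refl to ≋-refl; sym to ≋-sym; trans to ≋-trans; reflexive to ≡⇒≋)
module ≋-Reasoning = SetoidReasoning ≋-setoid

∷-cong : ∀ {a f g} → f ≋ g → a ∷ f ≋ a ∷ g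
∷-cong (coeffwise e) = coeffwise λ { zero → refl ; (suc k) → e k }

false∷-≋[] : ∀ {f} → f ≋ [] → false ∷ f ≋ []
false∷-≋[] (coeffwise e) = coeffwise λ { zero → refl ; (suc k) → e k }

⊕-cong : ∀ {f f′ g g′} → f ≋ f′ → g ≋ g′ → f ⊕ g ≋ f′ ⊕ g′
⊕-cong {f} {f′} {g} {g′} (coeffwise e) (coeffwise e′) = coeffwise λ k → begin
  coeff (f ⊕ g) k            ≡⟨ coeff-⊕ f g k ⟩
  coeff f k xor coeff g k    ≡⟨ cong₂ _xor_ (e k) (e′ k) ⟩
  coeff f′ k xor coeff g′ k  ≡⟨ sym (coeff-⊕ f′ g′ k) ⟩
  coeff (f′ ⊕ g′) k          ∎
  where open ≡-Reasoning

⊕-self : ∀ f → f ⊕ f ≋ []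
⊕-self []      = coeffwise λ k → refl
⊕-self (a ∷ f) rewrite xor-same a = false∷-≋[] (⊕-self f)

⊕-cancelˡ : ∀ f g → f ⊕ (f ⊕ g) ≋ g
⊕-cancelˡ f g = begin
  f ⊕ (f ⊕ g)  ≡⟨ sym (⊕-assoc f f g) ⟩
  (f ⊕ f) ⊕ g  ≈⟨ ⊕-cong (⊕-self f) ≋-refl ⟩
  g            ∎
  where open ≋-Reasoning

⊗-zeroʳ : ∀ p → p ⊗ [] ≋ []
⊗-zeroʳ []          = coeffwise λ k → refl
⊗-zeroʳ (true ∷ p)  = false∷-≋[] (⊗-zeroʳ p)
⊗-zeroʳ (false ∷ p) = false∷-≋[] (⊗-zeroʳ p)

⊗-distribˡ-⊕ : ∀ p q r → p ⊗ (q ⊕ r) ≡ p ⊗ q ⊕ p ⊗ r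
⊗-distribˡ-⊕ []          q r = refl
⊗-distribˡ-⊕ (true ∷ p)  q r = begin
  (q ⊕ r) ⊕ (false ∷ p ⊗ (q ⊕ r))                  ≡⟨ cong (λ s → (q ⊕ r) ⊕ (false ∷ s)) (⊗-distribˡ-⊕ p q r) ⟩
  (q ⊕ r) ⊕ ((false ∷ p ⊗ q) ⊕ (false ∷ p ⊗ r))    ≡⟨ ⊕-interchange q r _ _ ⟩
  (q ⊕ (false ∷ p ⊗ q)) ⊕ (r ⊕ (false ∷ p ⊗ r))    ∎
  where open ≡-Reasoning
⊗-distribˡ-⊕ (false ∷ p) q r = cong (false ∷_) (⊗-distribˡ-⊕ p q r)

⊗-shiftʳ : ∀ p q → p ⊗ (false ∷ q) ≋ false ∷ p ⊗ q
⊗-shiftʳ []          q = ≋-sym (false∷-≋[] ≋-refl)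
⊗-shiftʳ (true ∷ p)  q = ∷-cong (⊕-cong ≋-refl (⊗-shiftʳ p q))
⊗-shiftʳ (false ∷ p) q = ∷-cong (⊗-shiftʳ p q)

-- Over GF(2) the difference f − g is f ⊕ g.
infix 4 _≡_mod_
record _≡_mod_ (f g p : Poly) : Set where
  constructor divides-sum
  field
    quotient : Poly
    f⊕g≋p⊗q  : f ⊕ g ≋ p ⊗ quotient

≋⇒≡-mod : ∀ {f g p} → f ≋ g → f ≡ g mod p
≋⇒≡-mod {f} {g} {p} f≋g = divides-sum [] (begin
  f ⊕ g   ≈⟨ ⊕-cong f≋g ≋-refl ⟩
  g ⊕ g   ≈⟨ ⊕-self g ⟩
  []      ≈⟨ ⊗-zeroʳ p ⟨
  p ⊗ []  ∎)
  where open ≋-Reasoning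

≡-mod-sym : ∀ {f g p} → f ≡ g mod p → g ≡ f mod p
≡-mod-sym {f} {g} (divides-sum q e) = divides-sum q (≋-trans (≡⇒≋ (⊕-comm g f)) e)

⊕-cong-mod : ∀ {f f′ g g′ p} → f ≡ f′ mod p → g ≡ g′ mod p → f ⊕ g ≡ f′ ⊕ g′ mod p
⊕-cong-mod {f} {f′} {g} {g′} {p} (divides-sum q e) (divides-sum r e′) = divides-sum (q ⊕ r) (begin
  (f ⊕ g) ⊕ (f′ ⊕ g′)  ≡⟨ ⊕-interchange f g f′ g′ ⟩
  (f ⊕ f′) ⊕ (g ⊕ g′)  ≈⟨ ⊕-cong e e′ ⟩
  p ⊗ q ⊕ p ⊗ r        ≡⟨ ⊗-distribˡ-⊕ p q r ⟨
  p ⊗ (q ⊕ r)          ∎)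
  where open ≋-Reasoning

≡-mod-trans : ∀ {f g h p} → f ≡ g mod p → g ≡ h mod p → f ≡ h mod p
≡-mod-trans {f} {g} {h} {p} f≡g g≡h with ⊕-cong-mod f≡g g≡h
... | divides-sum q e = divides-sum q (begin
  f ⊕ h               ≈⟨ ⊕-cong ≋-refl (⊕-cancelˡ g h) ⟨
  f ⊕ (g ⊕ (g ⊕ h))   ≡⟨ ⊕-assoc f g (g ⊕ h) ⟨
  (f ⊕ g) ⊕ (g ⊕ h)   ≈⟨ e ⟩
  p ⊗ q               ∎)
  where open ≋-Reasoning

≡-mod-setoid : Poly → Setoid _ _
≡-mod-setoid p = record
  { Carrier       = Poly
  ; _≈_           = λ f g → f ≡ g mod p
  ; isEquivalence = record { refl = ≋⇒≡-mod ≋-refl ; sym = ≡-mod-sym ; trans = ≡-mod-trans }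
  }

module ≡-mod-Reasoning (p : Poly) = SetoidReasoning (≡-mod-setoid p)

≡-mod-shift : ∀ {f g p} → f ≡ g mod p → false ∷ f ≡ false ∷ g mod p
≡-mod-shift {p = p} (divides-sum q e) = divides-sum (false ∷ q) (≋-trans (∷-cong e) (≋-sym (⊗-shiftʳ p q)))

∣P-⊕⇒≡-mod : ∀ {p f g} → p ∣P (f ⊕ g) → f ≡ g mod p
∣P-⊕⇒≡-mod (q , e) = divides-sum q (coeffwise e)

∣P⇒≡0 : ∀ {p f} → p ∣P f → f ≡ [] mod p
∣P⇒≡0 {f = f} (q , e) = divides-sum q (≋-trans (≡⇒≋ (⊕-identityʳ f)) (coeffwise e))

≡0⇒∣P : ∀ {p f} → f ≡ [] mod p → p ∣P f
≡0⇒∣P {f = f} (divides-sum q e) = q , ≋⇒≈ (≋-trans (≡⇒≋ (sym (⊕-identityʳ f))) e)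

≡-mod⇒∣P⇔ : ∀ {f g p} → f ≡ g mod p → p ∣P f ⇔ p ∣P g
≡-mod⇒∣P⇔ f≡g = mk⇔
  (λ p∣f → ≡0⇒∣P (≡-mod-trans (≡-mod-sym f≡g) (∣P⇒≡0 p∣f)))
  (λ p∣g → ≡0⇒∣P (≡-mod-trans f≡g (∣P⇒≡0 p∣g)))

coeff-mono-≢ : ∀ {a c} → a ≢ c → coeff (mono a) c ≡ false
coeff-mono-≢ {zero}  {zero}  a≢c = ⊥-elim (a≢c refl)
coeff-mono-≢ {zero}  {suc c} _   = refl
coeff-mono-≢ {suc a} {zero}  _   = refl
coeff-mono-≢ {suc a} {suc c} a≢c = coeff-mono-≢ (a≢c ∘ cong suc)

weight-mono : ∀ a → weight (mono a) ≡ 1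
weight-mono zero    = refl
weight-mono (suc a) = weight-mono a

weight-mono-⊕ : ∀ c r → coeff r c ≡ false → weight (mono c ⊕ r) ≡ suc (weight r)
weight-mono-⊕ zero    []          _  = refl
weight-mono-⊕ zero    (false ∷ r) _  = refl
weight-mono-⊕ (suc c) []          _  = weight-mono c
weight-mono-⊕ (suc c) (true ∷ r)  rc = cong suc (weight-mono-⊕ c r rc)
weight-mono-⊕ (suc c) (false ∷ r) rc = weight-mono-⊕ c r rc

replicate-++-∷ : ∀ {A : Set} k (x : A) xs → replicate k x ++ x ∷ xs ≡ replicate (suc k) x ++ xs
replicate-++-∷ zero    x xs = refl
replicate-++-∷ (suc k) x xs = cong (x ∷_) (replicate-++-∷ k x xs)

replicate-false-++-[] : ∀ k → replicate k false ++ [] ≋ []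
replicate-false-++-[] zero    = ≋-refl
replicate-false-++-[] (suc k) = false∷-≋[] (replicate-false-++-[] k)

replicate-false-++-true∷ : ∀ k h → replicate k false ++ true ∷ h ≋ mono k ⊕ (replicate (suc k) false ++ h)
replicate-false-++-true∷ zero    h = ≋-refl
replicate-false-++-true∷ (suc k) h = ∷-cong (replicate-false-++-true∷ k h)

coeff-⊕-false : ∀ f g c → coeff f c ≡ false → coeff g c ≡ false → coeff (f ⊕ g) c ≡ false
coeff-⊕-false f g c fc gc = trans (coeff-⊕ f g c) (cong₂ _xor_ fc gc)

module _ (n : ℕ) .{{_ : NonZero n}} where

  %-+-suc : ∀ k a → (k + suc a) % n ≡ (suc k + a) % n
  %-+-suc k a = cong (_% n) (+-suc k a)

  phiAux-degreeBelow : ∀ k h → DegreeBelow (phiAux n k h) n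
  phiAux-degreeBelow k []          c _   = refl
  phiAux-degreeBelow k (true ∷ h)  c n≤c = coeff-⊕-false (mono (k % n)) (phiAux n (suc k) h) c
    (coeff-mono-≢ (<⇒≢ (<-≤-trans (m%n<n k n) n≤c)))
    (phiAux-degreeBelow (suc k) h c n≤c)
  phiAux-degreeBelow k (false ∷ h) c n≤c = phiAux-degreeBelow (suc k) h c n≤c

  coeff-phiAux : ∀ k h c → (∀ a → coeff h a ≡ true → (k + a) % n ≢ c) → coeff (phiAux n k h) c ≡ false
  coeff-phiAux k []          c _    = refl
  coeff-phiAux k (true ∷ h)  c miss = coeff-⊕-false (mono (k % n)) (phiAux n (suc k) h) c
    (coeff-mono-≢ (miss 0 refl ∘ trans (cong (_% n) (+-identityʳ k))))
    (coeff-phiAux (suc k) h c λ a ha → miss (suc a) ha ∘ trans (%-+-suc k a))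
  coeff-phiAux k (false ∷ h) c miss =
    coeff-phiAux (suc k) h c λ a ha → miss (suc a) ha ∘ trans (%-+-suc k a)

  IncongruentExponents : ℕ → Poly → Set
  IncongruentExponents k h = ∀ a b → a ≢ b → coeff h a ≡ true → coeff h b ≡ true
    → ¬ CongMod n (k + a) (k + b)

  incongruent-tail : ∀ {k x h} → IncongruentExponents k (x ∷ h) → IncongruentExponents (suc k) h
  incongruent-tail {k} inc a b a≢b ha hb ka≡kb = inc (suc a) (suc b) (a≢b ∘ suc-injective) ha hb
    (trans (%-+-suc k a) (trans ka≡kb (sym (%-+-suc k b))))

  weight-phiAux : ∀ k h → IncongruentExponents k h → weight (phiAux n k h) ≡ weight h
  weight-phiAux k []          _   = refl
  weight-phiAux k (true ∷ h)  inc =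
    trans (weight-mono-⊕ (k % n) _ k%n-free) (cong suc (weight-phiAux (suc k) h (incongruent-tail inc)))
    where
    k%n-free : coeff (phiAux n (suc k) h) (k % n) ≡ false
    k%n-free = coeff-phiAux (suc k) h (k % n) λ a ha ka≡k → inc 0 (suc a) (λ ()) refl ha
      (trans (cong (_% n) (+-identityʳ k)) (sym (trans (%-+-suc k a) ka≡k)))
  weight-phiAux k (false ∷ h) inc = weight-phiAux (suc k) h (incongruent-tail inc)

module ReductionModulo (n : ℕ) .{{_ : NonZero n}} (p : Poly) (p∣Xⁿ+1 : p ∣P (mono n ⊕ oneP)) where

  mono-+n : ∀ a → mono (a + n) ≡ mono a mod p
  mono-+n zero    = ∣P-⊕⇒≡-mod p∣Xⁿ+1
  mono-+n (suc a) = ≡-mod-shift (mono-+n a)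

  mono-+*n : ∀ q a → mono (a + q * n) ≡ mono a mod p
  mono-+*n zero    a = ≋⇒≡-mod (≡⇒≋ (cong mono (+-identityʳ a)))
  mono-+*n (suc q) a = begin
    mono (a + (n + q * n))  ≡⟨ cong mono (+-assoc a n (q * n)) ⟨
    mono (a + n + q * n)    ≈⟨ mono-+*n q (a + n) ⟩
    mono (a + n)            ≈⟨ mono-+n a ⟩
    mono a                  ∎
    where open ≡-mod-Reasoning p

  mono≡mono-% : ∀ a → mono a ≡ mono (a % n) mod p
  mono≡mono-% a = begin
    mono a                        ≡⟨ cong mono (m≡m%n+[m/n]*n a n) ⟩
    mono (a % n + (a / n) * n)    ≈⟨ mono-+*n (a / n) (a % n) ⟩
    mono (a % n)                  ∎
    where open ≡-mod-Reasoning p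

  mono-cong-mod : ∀ {a b} → CongMod n a b → mono a ≡ mono b mod p
  mono-cong-mod {a} {b} a≡b = begin
    mono a        ≈⟨ mono≡mono-% a ⟩
    mono (a % n)  ≡⟨ cong mono a≡b ⟩
    mono (b % n)  ≈⟨ mono≡mono-% b ⟨
    mono b        ∎
    where open ≡-mod-Reasoning p

  pairSum : List (ℕ × ℕ) → Poly
  pairSum = foldr (λ pr acc → pairPoly n pr ⊕ acc) zeroP

  pairSum≡0 : ∀ ps → All (ValidPair n) ps → pairSum ps ≡ [] mod p
  pairSum≡0 []             []                = ≋⇒≡-mod ≋-refl
  pairSum≡0 ((a , b) ∷ ps) ((_ , a≡b) ∷ valid) = begin
    (mono a ⊕ mono b) ⊕ pairSum ps
      ≈⟨ ⊕-cong-mod (⊕-cong-mod (mono-cong-mod a≡b) (≋⇒≡-mod ≋-refl)) (pairSum≡0 ps valid) ⟩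
    (mono b ⊕ mono b) ⊕ []
      ≡⟨ ⊕-identityʳ (mono b ⊕ mono b) ⟩
    mono b ⊕ mono b
      ≈⟨ ≋⇒≡-mod (⊕-self (mono b)) ⟩
    []
      ∎
    where open ≡-mod-Reasoning p

  T≡0 : ∀ {i g} → InT n i g → g ≡ [] mod p
  T≡0 (ps , _ , valid , _ , g≈) = ≡-mod-trans (≋⇒≡-mod (coeffwise g≈)) (pairSum≡0 ps valid)

  -- replicate k false ++ h is X^k h, and phiAux n k h is φ(X^k h).
  shifted≡phiAux : ∀ k h → replicate k false ++ h ≡ phiAux n k h mod p
  shifted≡phiAux k []          = ≋⇒≡-mod (replicate-false-++-[] k)
  shifted≡phiAux k (true ∷ h)  = begin
    replicate k false ++ true ∷ h             ≈⟨ ≋⇒≡-mod (replicate-false-++-true∷ k h) ⟩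
    mono k ⊕ (replicate (suc k) false ++ h)   ≈⟨ ⊕-cong-mod (mono≡mono-% k) (shifted≡phiAux (suc k) h) ⟩
    mono (k % n) ⊕ phiAux n (suc k) h         ∎
    where open ≡-mod-Reasoning p
  shifted≡phiAux k (false ∷ h) = begin
    replicate k false ++ false ∷ h            ≡⟨ replicate-++-∷ k false h ⟩
    replicate (suc k) false ++ h              ≈⟨ shifted≡phiAux (suc k) h ⟩
    phiAux n (suc k) h                        ∎
    where open ≡-mod-Reasoning p

  ∣P⇔∣P-phi : ∀ f g h {i} → InT n i g → f ≈ g ⊕ h → p ∣P f ⇔ p ∣P phi n h
  ∣P⇔∣P-phi f g h g∈T f≈g⊕h = ≡-mod⇒∣P⇔ (begin
    f         ≈⟨ ≋⇒≡-mod (coeffwise f≈g⊕h) ⟩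
    g ⊕ h     ≈⟨ ⊕-cong-mod (T≡0 g∈T) (shifted≡phiAux 0 h) ⟩
    phi n h   ∎)
    where open ≡-mod-Reasoning p

theorem2 : (m : ℕ) (m>1 : 1 < m) (p : Poly)
    → HasDegree p m → Irreducible p → Primitive m p
    → (f g h : Poly) (i j : ℕ)
    → InT (2 ^ m ∸ 1) {{nonZero-n m m>1}} i g
    → weight h ≡ j
    → (∀ a b → a ≢ b → coeff h a ≡ true → coeff h b ≡ true
         → ¬ CongMod (2 ^ m ∸ 1) {{nonZero-n m m>1}} a b)
    → (∀ a → coeff g a ≡ true → coeff h a ≡ true → ⊥)
    → f ≈ g ⊕ h
    → (p ∣P f) ⇔ InA (2 ^ m ∸ 1) {{nonZero-n m m>1}} p j (phi (2 ^ m ∸ 1) {{nonZero-n m m>1}} h)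
theorem2 m m>1 p _ _ (p∣Xⁿ+1 , _) f g h i j g∈T weight-h incongruent _ f≈g⊕h = mk⇔
  (λ p∣f → (phiAux-degreeBelow n 0 h , to p∣f) , trans (weight-phiAux n 0 h incongruent) weight-h)
  (λ ((_ , p∣φh) , _) → from p∣φh)
  where
  n : ℕ
  n = 2 ^ m ∸ 1
  instance
    n-nonZero : NonZero n
    n-nonZero = nonZero-n m m>1
  open ReductionModulo n p p∣Xⁿ+1
  open Equivalence (∣P⇔∣P-phi f g h g∈T f≈g⊕h)
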